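{- If $f$ is a stuttering function of a team $T$, then $|T|=|T[f]|$.
   Context: A trace is an infinite sequence $t=t(0)t(1)\cdots$ of sets of propositions; a team is a set of traces. A stuttering function of a trace $t$ is a strictly increasing $f:\mathbb N\to\mathbb N$ with $f(0)=0$ and $t(f(k))=t(f(k)+1)=\cdots=t(f(k+1)-1)$ for all $k$. A stuttering function of a team $T$ is a function that is a stuttering function of every $t\in T$. For $f:\mathbb N\to\mathbb N$, $t[f]=t(f(0))t(f(1))t(f(2))\cdots$ and $T[f]=\{t[f]\mid t\in T\}$. -}

module Defs where

open import Data.Nat using (ℕ; zero; suc; _≤_; _<_)
open import Data.Bool using (Bool)
open import Data.Product using (Σ; ∃; _×_; _,_; proj₁)
open import Relation.Binary.PropositionalEquality using (_≡_; refl; sym; trans)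
open import Relation.Binary.Bundles using (Setoid)
open import Function.Bundles using (Bijection)

PropSet : Set → Set
PropSet AP = AP → Bool

_≐_ : {AP : Set} → PropSet AP → PropSet AP → Set
A ≐ B = ∀ p → A p ≡ B p

Trace : Set → Set
Trace AP = ℕ → PropSet AP

_≈ₜ_ : {AP : Set} → Trace AP → Trace AP → Set
t ≈ₜ u = ∀ i → t i ≐ u i

Team : Set → Set₁
Team AP = Trace AP → Set

IsStutteringFunction : {AP : Set} → (ℕ → ℕ) → Trace AP → Set
IsStutteringFunction f t =
  (∀ m n → m < n → f m < f n) ×
  (f 0 ≡ 0) ×
  (∀ k i → f k ≤ i → i < f (suc k) → t i ≐ t (f k))

IsTeamStutteringFunction : {AP : Set} → (ℕ → ℕ) → Team AP → Set
IsTeamStutteringFunction f T = ∀ t → T t → IsStutteringFunction f t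

_[_]ₜ : {AP : Set} → Trace AP → (ℕ → ℕ) → Trace AP
(t [ f ]ₜ) k = t (f k)

_[_]ₜₘ : {AP : Set} → Team AP → (ℕ → ℕ) → Team AP
(T [ f ]ₜₘ) s = ∃ λ t → T t × (s ≈ₜ (t [ f ]ₜ))

TeamSetoid : {AP : Set} → Team AP → Setoid _ _
TeamSetoid {AP} T = record
  { Carrier = Σ (Trace AP) T
  ; _≈_ = λ x y → proj₁ x ≈ₜ proj₁ y
  ; isEquivalence = record
    { refl = λ i p → refl
    ; sym = λ e i p → sym (e i p)
    ; trans = λ e e' i p → trans (e i p) (e' i p)
    }
  }

SameCard : {AP : Set} → Team AP → Team AP → Set
SameCard T U = Bijection (TeamSetoid T) (TeamSetoid U)

module Submission where

open import Defs
open import Data.Nat using (ℕ; zero; suc; _≤_; _<_; z≤n)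
open import Data.Nat.Properties using (≤-refl; ≤-reflexive; ≤-trans; n≤1+n; m≤n⇒m<n∨m≡n)
open import Data.Product using (Σ; ∃; _×_; _,_; proj₁; proj₂)
open import Data.Sum using (inj₁; inj₂)
open import Relation.Binary.PropositionalEquality using (_≡_; refl; sym; trans; subst)

-- A stuttering function cuts ℕ into the blocks [f k, f (k+1)); on each block t is
-- constant, so t is determined by its reduct t[f], which makes t ↦ t[f] injective.

block-containing : (f : ℕ → ℕ) → (∀ k → f k < f (suc k)) → f 0 ≡ 0 →
  (i : ℕ) → ∃ λ k → f k ≤ i × i < f (suc k)
block-containing f step f0 zero =
  0 , subst (_≤ 0) (sym f0) z≤n , subst (_< f 1) f0 (step 0)
block-containing f step f0 (suc i) with block-containing f step f0 i
... | k , fk≤i , i<fk+1 with m≤n⇒m<n∨m≡n i<fk+1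
...   | inj₁ i+1<fk+1 = k , ≤-trans fk≤i (n≤1+n i) , i+1<fk+1
...   | inj₂ i+1≡fk+1 =
  suc k , ≤-reflexive (sym i+1≡fk+1) , subst (_< f (suc (suc k))) (sym i+1≡fk+1) (step (suc k))

stuttering-step : ∀ {AP} {f : ℕ → ℕ} {t : Trace AP} →
  IsStutteringFunction f t → ∀ k → f k < f (suc k)
stuttering-step (mono , _ , _) k = mono k (suc k) ≤-refl

[]ₜ-cong : ∀ {AP} {t u : Trace AP} (f : ℕ → ℕ) → t ≈ₜ u → (t [ f ]ₜ) ≈ₜ (u [ f ]ₜ)
[]ₜ-cong f t≈u k = t≈u (f k)

[]ₜ-injective : ∀ {AP} {f : ℕ → ℕ} {t u : Trace AP} →
  IsStutteringFunction f t → IsStutteringFunction f u →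
  (t [ f ]ₜ) ≈ₜ (u [ f ]ₜ) → t ≈ₜ u
[]ₜ-injective {f = f} st@(_ , f0 , t-const) (_ , _ , u-const) t[f]≈u[f] i p
  with block-containing f (stuttering-step st) f0 i
... | k , fk≤i , i<fk+1 =
  trans (t-const k i fk≤i i<fk+1 p)
        (trans (t[f]≈u[f] k p) (sym (u-const k i fk≤i i<fk+1 p)))

proposition20 : {AP : Set} (T : Team AP) (f : ℕ → ℕ) →
    IsTeamStutteringFunction f T → SameCard T (T [ f ]ₜₘ)
proposition20 {AP} T f st = record
  { to        = reduct
  ; cong      = []ₜ-cong f
  ; bijective = (λ {x} {y} → []ₜ-injective (st _ (proj₂ x)) (st _ (proj₂ y)))
              , reduct-surjective
  }
  where
  reduct : Σ (Trace AP) T → Σ (Trace AP) (T [ f ]ₜₘ)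
  reduct (t , Tt) = (t [ f ]ₜ) , t , Tt , λ _ _ → refl

  reduct-surjective : (s : Σ (Trace AP) (T [ f ]ₜₘ)) → ∃ λ (x : Σ (Trace AP) T) →
    ∀ {y : Σ (Trace AP) T} → proj₁ y ≈ₜ proj₁ x → (proj₁ y [ f ]ₜ) ≈ₜ proj₁ s
  reduct-surjective (s , t , Tt , s≈t[f]) =
    (t , Tt) , λ y≈t k p → trans ([]ₜ-cong f y≈t k p) (sym (s≈t[f] k p))
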